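{- Let $n\ge 2$. The complete bipartite graph $K(2,n)$ is $k$-super graceful if and only if $k\in\{1,2,n\}$.
   Context: For integers $a\le b$, $[a,b]$ is the set of integers between $a$ and $b$ inclusive. For $k\ge 1$, a $k$-super graceful labeling of a graph $G=(V,E)$ with $p$ vertices and $q$ edges is a bijection $f:V\cup E\to[k,k+p+q-1]$ with $f(uv)=|f(u)-f(v)|$ for every edge $uv$; $G$ is $k$-super graceful if it admits one. $K(m,n)$ is the complete bipartite graph with parts of sizes $m$ and $n$. -}

module Defs where

open import Data.Nat using (ℕ; _+_; _*_; _∸_; _≤_; ∣_-_∣)
open import Data.Fin using (Fin)
open import Data.Fin.Properties using (+↔⊎; *↔×)
open import Data.Product using (_×_; _,_; Σ; ∃)
open import Data.Sum using (_⊎_; inj₁; inj₂; [_,_])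
open import Function.Bundles using (_↔_)
open import Function.Properties.Inverse using (↔-sym)
open import Relation.Binary.PropositionalEquality using (_≡_)

record Graph : Set₁ where
  field
    V     : Set
    E     : Set
    p     : ℕ
    q     : ℕ
    V↔Fin : V ↔ Fin p
    E↔Fin : E ↔ Fin q
    ends  : E → V × V

open Graph public

InInterval : ℕ → ℕ → ℕ → Set
InInterval a b x = a ≤ x × x ≤ b

record IsSuperGraceful (k : ℕ) (G : Graph) (f : V G ⊎ E G → ℕ) : Set where
  field
    injective  : ∀ x y → f x ≡ f y → x ≡ y
    into       : ∀ x → InInterval k (k + p G + q G ∸ 1) (f x)
    onto       : ∀ m → InInterval k (k + p G + q G ∸ 1) m → ∃ λ x → f x ≡ m
    edge-label : ∀ e → let (u , v) = ends G e in
                   f (inj₂ e) ≡ ∣ f (inj₁ u) - f (inj₁ v) ∣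

SuperGraceful : ℕ → Graph → Set
SuperGraceful k G = Σ (V G ⊎ E G → ℕ) (IsSuperGraceful k G)

K : ℕ → ℕ → Graph
K m n = record
  { V = Fin m ⊎ Fin n
  ; E = Fin m × Fin n
  ; p = m + n
  ; q = m * n
  ; V↔Fin = ↔-sym +↔⊎
  ; E↔Fin = ↔-sym *↔×
  ; ends = λ { (i , j) → inj₁ i , inj₂ j }
  }

module Submission where

-- A bijection from vertices and edges onto the positions
-- 0 … p + q - 1 becomes a k-super graceful labeling after shifting by k,
-- provided every edge sits k positions above the difference of its ends
-- (fromPositions).
--
-- Let s < a be the labels of the small side
-- and measure labels by their depth below the top label M.  Every label above
-- a is a B-vertex or an edge going down from one to s or to a, so the depths
-- of the B-vertices, translated by {0, s, a}, tile the depths above a exactly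
-- once and miss a itself.  A purely combinatorial analysis of such prefix
-- tilings (PrefixTiling) leaves only the shape M - a = 2(m+1)s, a = M - a + 1.
-- Reading one well-chosen label shows that m = 0 and k = s (Smallest) or
-- gives a collision (Larger); counting labels then gives n = k.

open import Defs
open import Data.Nat
open import Data.Nat.Properties
open import Data.Fin using (Fin; zero; suc; toℕ; fromℕ<; cast; opposite)
open import Data.Fin.Properties
  using (toℕ<n; toℕ-injective; toℕ-fromℕ<; toℕ-cast; cast-involutive; toℕ-↑ʳ; toℕ-↑ˡ; toℕ-combine; opposite-prop; opposite-involutive; +↔⊎; *↔×)
open import Data.Sum using (_⊎_; inj₁; inj₂)
open import Data.Sum.Algebra using (⊎-cong)
open import Data.Product using (∃; _×_; _,_; proj₁; proj₂)
open import Data.Empty using (⊥; ⊥-elim)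
open import Relation.Nullary using (¬_; contradiction; yes; no)
open import Relation.Binary using (tri<; tri≈; tri>)
open import Relation.Binary.PropositionalEquality
open import Function.Bundles using (_↔_; _⇔_; mk⇔; mk↔ₛ′; Inverse)
open import Function.Properties.Inverse using (↔-sym; ↔-trans; ↔-refl)
open import Data.Nat.Tactic.RingSolver using (solve-∀)

fromPositions : ∀ (G : Graph) k → 0 < p G + q G →
  (pos : (V G ⊎ E G) ↔ Fin (p G + q G)) →
  (∀ e → k + toℕ (Inverse.to pos (inj₂ e)) ≡
     ∣ toℕ (Inverse.to pos (inj₁ (proj₁ (ends G e)))) - toℕ (Inverse.to pos (inj₁ (proj₂ (ends G e)))) ∣) →
  SuperGraceful k G
fromPositions G k 0<N pos edge = label , record
  { injective  = λ x y eq → begin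
      x              ≡⟨ strictlyInverseʳ x ⟨
      from (to x)    ≡⟨ cong from (toℕ-injective (+-cancelˡ-≡ k _ _ eq)) ⟩
      from (to y)    ≡⟨ strictlyInverseʳ y ⟩
      y              ∎
  ; into       = λ x → m≤m+n k (at x) , shift-≤ (toℕ<n (to x))
  ; onto       = λ m (k≤m , m≤max) →
      from (fromℕ< (unshift k≤m m≤max)) ,
      (begin
        k + toℕ (to (from (fromℕ< (unshift k≤m m≤max))))
          ≡⟨ cong (λ i → k + toℕ i) (strictlyInverseˡ _) ⟩
        k + toℕ (fromℕ< (unshift k≤m m≤max))
          ≡⟨ cong (k +_) (toℕ-fromℕ< _) ⟩
        k + (m ∸ k)
          ≡⟨ m+[n∸m]≡n k≤m ⟩
        m ∎)
  ; edge-label = λ e → trans (edge e) (sym (∣m+n-m+o∣≡∣n-o∣ k _ _))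
  }
  where
  open Inverse pos
  open ≡-Reasoning
  N = p G + q G
  at : V G ⊎ E G → ℕ
  at x = toℕ (to x)
  label : V G ⊎ E G → ℕ
  label x = k + at x
  top : k + p G + q G ∸ 1 ≡ k + (N ∸ 1)
  top = trans (cong (_∸ 1) (+-assoc k (p G) (q G))) (+-∸-assoc k 0<N)
  pred-N : suc (N ∸ 1) ≡ N
  pred-N = suc-pred N ⦃ >-nonZero 0<N ⦄
  shift-≤ : ∀ {t} → t < N → k + t ≤ k + p G + q G ∸ 1
  shift-≤ {t} t<N = subst (k + t ≤_) (sym top) (+-monoʳ-≤ k (≤-pred (subst (suc t ≤_) (sym pred-N) t<N)))
  unshift : ∀ {m} → k ≤ m → m ≤ k + p G + q G ∸ 1 → m ∸ k < N
  unshift {m} k≤m m≤max = subst (suc (m ∸ k) ≤_) pred-N (s≤s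
    (subst (m ∸ k ≤_) (m+n∸m≡n k (N ∸ 1)) (∸-monoˡ-≤ k (subst (m ≤_) top m≤max))))

cast↔ : ∀ {m m'} → m ≡ m' → Fin m ↔ Fin m'
cast↔ eq = mk↔ₛ′ (cast eq) (cast (sym eq)) (cast-involutive eq (sym eq)) (cast-involutive (sym eq) eq)

_then_ : ∀ {A B : Set} {m m'} → A ↔ Fin m → B ↔ Fin m' → (A ⊎ B) ↔ Fin (m + m')
f then g = ↔-trans (⊎-cong f g) (↔-sym +↔⊎)

rows : ∀ m m' → (Fin m × Fin m') ↔ Fin (m * m')
rows m m' = ↔-sym *↔×

module _ {A B : Set} {m m'} (f : A ↔ Fin m) (g : B ↔ Fin m') where
  open Inverse
  toℕ-then-inj₁ : ∀ x → toℕ (to (f then g) (inj₁ x)) ≡ toℕ (to f x)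
  toℕ-then-inj₁ x = toℕ-↑ˡ (to f x) m'
  toℕ-then-inj₂ : ∀ y → toℕ (to (f then g) (inj₂ y)) ≡ m + toℕ (to g y)
  toℕ-then-inj₂ y = toℕ-↑ʳ m (to g y)

toℕ-rows : ∀ {m m'} (i : Fin m) (j : Fin m') → toℕ (Inverse.to (rows m m') (i , j)) ≡ m' * toℕ i + toℕ j
toℕ-rows i j = toℕ-combine i j

pattern A i = inj₁ (inj₁ i)
pattern B j = inj₁ (inj₂ j)
pattern edge i j = inj₂ (i , j)

Slot : ℕ → Set
Slot n = V (K 2 n) ⊎ E (K 2 n)

module Arrangement {n m} {S : Set} (shape : Slot n ↔ S) (layout : S ↔ Fin m) (size : m ≡ (2 + n) + 2 * n) where
  positions : Slot n ↔ Fin ((2 + n) + 2 * n)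
  positions = ↔-trans shape (↔-trans layout (cast↔ size))

  at : Slot n → ℕ
  at x = toℕ (Inverse.to positions x)

  at-layout : ∀ x → at x ≡ toℕ (Inverse.to layout (Inverse.to shape x))
  at-layout x = toℕ-cast size _

dist-up : ∀ x y d → x + d ≡ y → ∣ x - y ∣ ≡ d
dist-up x _ d refl = ∣m-m+n∣≡n x d

dist-down : ∀ x y d → y + d ≡ x → ∣ x - y ∣ ≡ d
dist-down _ y d refl = trans (∣-∣-comm (y + d) y) (∣m-m+n∣≡n y d)

-- k = 1: positions A 0, A 1, then for each j the triple
-- edge 1 j, edge 0 j, B j; that is the edge (i , j) at 3j + 3 - i and B j at 3j + 4.
module Labeling1 (n : ℕ) where
  shape : Slot n ↔ (Fin 2 ⊎ (Fin n × Fin 3))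
  shape = mk↔ₛ′ to from to-from from-to
    where
    to : Slot n → Fin 2 ⊎ (Fin n × Fin 3)
    to (A i)               = inj₁ i
    to (edge (suc zero) j) = inj₂ (j , zero)
    to (edge zero j)       = inj₂ (j , suc zero)
    to (B j)               = inj₂ (j , suc (suc zero))
    from : Fin 2 ⊎ (Fin n × Fin 3) → Slot n
    from (inj₁ i)                    = A i
    from (inj₂ (j , zero))           = edge (suc zero) j
    from (inj₂ (j , suc zero))       = edge zero j
    from (inj₂ (j , suc (suc zero))) = B j
    to-from : ∀ y → to (from y) ≡ y
    to-from (inj₁ i)                    = refl
    to-from (inj₂ (j , zero))           = refl
    to-from (inj₂ (j , suc zero))       = refl
    to-from (inj₂ (j , suc (suc zero))) = refl
    from-to : ∀ x → from (to x) ≡ x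
    from-to (A i)               = refl
    from-to (edge zero j)       = refl
    from-to (edge (suc zero) j) = refl
    from-to (B j)               = refl

  layout : (Fin 2 ⊎ (Fin n × Fin 3)) ↔ Fin (2 + n * 3)
  layout = ↔-refl {A = Fin 2} then rows n 3

  size : ∀ n → 2 + n * 3 ≡ (2 + n) + 2 * n
  size = solve-∀

  open Arrangement shape layout (size n)

  at-triple : ∀ j c → toℕ (Inverse.to layout (inj₂ (j , c))) ≡ 2 + (3 * toℕ j + toℕ c)
  at-triple j c = trans (toℕ-then-inj₂ (↔-refl {A = Fin 2}) (rows n 3) (j , c)) (cong (2 +_) (toℕ-rows j c))

  at-A : ∀ i → at (A i) ≡ toℕ i
  at-A i = trans (at-layout (A i)) (toℕ-then-inj₁ (↔-refl {A = Fin 2}) (rows n 3) i)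

  at-B : ∀ j → at (B j) ≡ 2 + (3 * toℕ j + 2)
  at-B j = trans (at-layout (B j)) (at-triple j (suc (suc zero)))

  at-edge : ∀ i j → at (edge i j) ≡ 2 + (3 * toℕ j + (1 ∸ toℕ i))
  at-edge zero j       = trans (at-layout (edge zero j)) (at-triple j (suc zero))
  at-edge (suc zero) j = trans (at-layout (edge (suc zero) j)) (at-triple j zero)

  edges : ∀ i j → 1 + at (edge i j) ≡ ∣ at (A i) - at (B j) ∣
  edges i j = sym (dist-up (at (A i)) (at (B j)) _ (begin
    at (A i) + (1 + at (edge i j))                     ≡⟨ cong₂ (λ a e → a + (1 + e)) (at-A i) (at-edge i j) ⟩
    toℕ i + (1 + (2 + (3 * toℕ j + (1 ∸ toℕ i))))      ≡⟨ by-ring i (toℕ j) ⟩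
    2 + (3 * toℕ j + 2)                                ≡⟨ at-B j ⟨
    at (B j)                                           ∎))
    where
    open ≡-Reasoning
    by-ring : ∀ (i : Fin 2) j → toℕ i + (1 + (2 + (3 * j + (1 ∸ toℕ i)))) ≡ 2 + (3 * j + 2)
    by-ring zero       = solve-∀
    by-ring (suc zero) = solve-∀

  labeling : SuperGraceful 1 (K 2 n)
  labeling = fromPositions (K 2 n) 1 (s≤s z≤n) positions (λ (i , j) → edges i j)

-- k = 2: for each j the triple B (n-1-j), edge 0 j, edge 1 j, then A 0, A 1;
-- that is B j at 3(n-1-j), the edge (i , j) at 3j + 1 + i and A i at 3n + i.
module Labeling2 (n : ℕ) where
  shape : Slot n ↔ ((Fin n × Fin 3) ⊎ Fin 2)
  shape = mk↔ₛ′ to from to-from from-to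
    where
    to : Slot n → (Fin n × Fin 3) ⊎ Fin 2
    to (B j)               = inj₁ (opposite j , zero)
    to (edge zero j)       = inj₁ (j , suc zero)
    to (edge (suc zero) j) = inj₁ (j , suc (suc zero))
    to (A i)               = inj₂ i
    from : (Fin n × Fin 3) ⊎ Fin 2 → Slot n
    from (inj₁ (j , zero))           = B (opposite j)
    from (inj₁ (j , suc zero))       = edge zero j
    from (inj₁ (j , suc (suc zero))) = edge (suc zero) j
    from (inj₂ i)                    = A i
    to-from : ∀ y → to (from y) ≡ y
    to-from (inj₁ (j , zero))           = cong (λ j' → inj₁ (j' , zero)) (opposite-involutive j)
    to-from (inj₁ (j , suc zero))       = refl
    to-from (inj₁ (j , suc (suc zero))) = refl
    to-from (inj₂ i)                    = refl
    from-to : ∀ x → from (to x) ≡ x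
    from-to (B j)               = cong B (opposite-involutive j)
    from-to (edge zero j)       = refl
    from-to (edge (suc zero) j) = refl
    from-to (A i)               = refl

  layout : ((Fin n × Fin 3) ⊎ Fin 2) ↔ Fin (n * 3 + 2)
  layout = rows n 3 then ↔-refl {A = Fin 2}

  size : ∀ n → n * 3 + 2 ≡ (2 + n) + 2 * n
  size = solve-∀

  open Arrangement shape layout (size n)

  at-triple : ∀ j c → toℕ (Inverse.to layout (inj₁ (j , c))) ≡ 3 * toℕ j + toℕ c
  at-triple j c = trans (toℕ-then-inj₁ (rows n 3) (↔-refl {A = Fin 2}) (j , c)) (toℕ-rows j c)

  at-A : ∀ i → at (A i) ≡ n * 3 + toℕ i
  at-A i = trans (at-layout (A i)) (toℕ-then-inj₂ (rows n 3) (↔-refl {A = Fin 2}) i)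

  at-B : ∀ j → at (B j) ≡ 3 * toℕ (opposite j) + 0
  at-B j = trans (at-layout (B j)) (at-triple (opposite j) zero)

  at-edge : ∀ i j → at (edge i j) ≡ 3 * toℕ j + suc (toℕ i)
  at-edge zero j       = trans (at-layout (edge zero j)) (at-triple j (suc zero))
  at-edge (suc zero) j = trans (at-layout (edge (suc zero) j)) (at-triple j (suc (suc zero)))

  opposite-sum : ∀ (j : Fin n) → toℕ (opposite j) + suc (toℕ j) ≡ n
  opposite-sum j = trans (cong (_+ suc (toℕ j)) (opposite-prop j)) (m∸n+n≡m (toℕ<n j))

  edges : ∀ i j → 2 + at (edge i j) ≡ ∣ at (A i) - at (B j) ∣
  edges i j = sym (dist-down (at (A i)) (at (B j)) _ (begin
    at (B j) + (2 + at (edge i j))                            ≡⟨ cong₂ (λ b e → b + (2 + e)) (at-B j) (at-edge i j) ⟩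
    3 * o + 0 + (2 + (3 * toℕ j + suc (toℕ i)))               ≡⟨ by-ring o (toℕ j) (toℕ i) ⟩
    (o + suc (toℕ j)) * 3 + toℕ i                             ≡⟨ cong (λ m → m * 3 + toℕ i) (opposite-sum j) ⟩
    n * 3 + toℕ i                                             ≡⟨ at-A i ⟨
    at (A i)                                                  ∎))
    where
    open ≡-Reasoning
    o = toℕ (opposite j)
    by-ring : ∀ o j i → 3 * o + 0 + (2 + (3 * j + suc i)) ≡ (o + suc j) * 3 + i
    by-ring = solve-∀

  labeling : SuperGraceful 2 (K 2 n)
  labeling = fromPositions (K 2 n) 2 (s≤s z≤n) positions (λ (i , j) → edges i j)

-- k = n: positions A 0, edge 1 0 … edge 1 (n-1), A 1, edge 0 0 … edge 0 (n-1),
-- B 0 … B (n-1); that is A i at (n+1)i, the edge (i , j) at (n+1)(1-i) + j + 1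
-- and B j at 2(n+1) + j.
module LabelingN (n : ℕ) where
  shape : Slot n ↔ ((Fin 2 × Fin (suc n)) ⊎ Fin n)
  shape = mk↔ₛ′ to from to-from from-to
    where
    to : Slot n → (Fin 2 × Fin (suc n)) ⊎ Fin n
    to (A i)               = inj₁ (i , zero)
    to (edge zero j)       = inj₁ (suc zero , suc j)
    to (edge (suc zero) j) = inj₁ (zero , suc j)
    to (B j)               = inj₂ j
    from : (Fin 2 × Fin (suc n)) ⊎ Fin n → Slot n
    from (inj₁ (i , zero))         = A i
    from (inj₁ (zero , suc j))     = edge (suc zero) j
    from (inj₁ (suc zero , suc j)) = edge zero j
    from (inj₂ j)                  = B j
    to-from : ∀ y → to (from y) ≡ y
    to-from (inj₁ (i , zero))         = refl
    to-from (inj₁ (zero , suc j))     = refl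
    to-from (inj₁ (suc zero , suc j)) = refl
    to-from (inj₂ j)                  = refl
    from-to : ∀ x → from (to x) ≡ x
    from-to (A i)               = refl
    from-to (edge zero j)       = refl
    from-to (edge (suc zero) j) = refl
    from-to (B j)               = refl

  layout : ((Fin 2 × Fin (suc n)) ⊎ Fin n) ↔ Fin (2 * suc n + n)
  layout = rows 2 (suc n) then ↔-refl

  size : ∀ n → 2 * suc n + n ≡ (2 + n) + 2 * n
  size = solve-∀

  open Arrangement shape layout (size n)

  at-row : ∀ i c → toℕ (Inverse.to layout (inj₁ (i , c))) ≡ suc n * toℕ i + toℕ c
  at-row i c = trans (toℕ-then-inj₁ (rows 2 (suc n)) (↔-refl {A = Fin n}) (i , c)) (toℕ-rows i c)

  at-A : ∀ i → at (A i) ≡ suc n * toℕ i + 0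
  at-A i = trans (at-layout (A i)) (at-row i zero)

  at-B : ∀ j → at (B j) ≡ 2 * suc n + toℕ j
  at-B j = trans (at-layout (B j)) (toℕ-then-inj₂ (rows 2 (suc n)) (↔-refl {A = Fin n}) j)

  at-edge : ∀ i j → at (edge i j) ≡ suc n * (1 ∸ toℕ i) + suc (toℕ j)
  at-edge zero j       = trans (at-layout (edge zero j)) (at-row (suc zero) (suc j))
  at-edge (suc zero) j = trans (at-layout (edge (suc zero) j)) (at-row zero (suc j))

  edges : ∀ i j → n + at (edge i j) ≡ ∣ at (A i) - at (B j) ∣
  edges i j = sym (dist-up (at (A i)) (at (B j)) _ (begin
    at (A i) + (n + at (edge i j))                                 ≡⟨ cong₂ (λ a e → a + (n + e)) (at-A i) (at-edge i j) ⟩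
    suc n * toℕ i + 0 + (n + (suc n * (1 ∸ toℕ i) + suc (toℕ j))) ≡⟨ by-ring i n (toℕ j) ⟩
    2 * suc n + toℕ j                                              ≡⟨ at-B j ⟨
    at (B j)                                                       ∎))
    where
    open ≡-Reasoning
    by-ring : ∀ (i : Fin 2) n j → suc n * toℕ i + 0 + (n + (suc n * (1 ∸ toℕ i) + suc j)) ≡ 2 * suc n + j
    by-ring zero       = solve-∀
    by-ring (suc zero) = solve-∀

  labeling : SuperGraceful n (K 2 n)
  labeling = fromPositions (K 2 n) n (s≤s z≤n) positions (λ (i , j) → edges i j)

Step : (ℕ → Set) → ℕ → ℕ → Set
Step S c z = ∃ λ w → w + c ≡ z × S w

-- z is covered by a translate of the tile {0, s, a} placed at a point of S.
Covered : (ℕ → Set) → ℕ → ℕ → ℕ → Set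
Covered S s a z = S z ⊎ Step S s z ⊎ Step S a z

step-≥ : ∀ {w c z} → w + c ≡ z → c ≤ z
step-≥ {w} {c} refl = m≤n+m c w

start-< : ∀ {w c z} → w + c ≡ z → 0 < c → w < z
start-< {w} refl 0<c = m<m+n w 0<c

start-<-pred : ∀ {w c z} → w + c ≡ suc z → 1 < c → w < z
start-<-pred {w} {suc c} e (s≤s 0<c) = start-< (suc-injective (trans (sym (+-suc w c)) e)) 0<c

same-start : ∀ {w w' c z} → w + c ≡ z → w' + c ≡ z → w ≡ w'
same-start {w} {w'} {c} e e' = +-cancelʳ-≡ c w w' (trans e (sym e'))

data Split₂ (s z : ℕ) : Set where
  first  : ∀ m r → r < s → m * (s + s) + r ≡ z → Split₂ s z
  second : ∀ m r → r < s → m * (s + s) + s + r ≡ z → Split₂ s z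

split₂ : ∀ {s} → 0 < s → ∀ z → Split₂ s z
split₂ 0<s zero = first 0 0 0<s refl
split₂ {s} 0<s (suc z) with split₂ 0<s z
... | first m r r<s e with m≤n⇒m<n∨m≡n r<s
...   | inj₁ r+1<s = first m (suc r) r+1<s (trans (+-suc _ r) (cong suc e))
...   | inj₂ refl  = second m 0 0<s (trans (by-ring m r) (cong suc e))
  where
  by-ring : ∀ m r → m * (suc r + suc r) + suc r + 0 ≡ suc (m * (suc r + suc r) + r)
  by-ring = solve-∀
split₂ {s} 0<s (suc z) | second m r r<s e with m≤n⇒m<n∨m≡n r<s
...   | inj₁ r+1<s = second m (suc r) r+1<s (trans (+-suc _ r) (cong suc e))
...   | inj₂ refl  = first (suc m) 0 0<s (trans (by-ring m r) (cong suc e))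
  where
  by-ring : ∀ m r → suc m * (suc r + suc r) + 0 ≡ suc (m * (suc r + suc r) + suc r + r)
  by-ring = solve-∀

data Split₃ (s z : ℕ) : Set where
  first  : ∀ m r → r < s → m * (s + s + s) + r ≡ z → Split₃ s z
  second : ∀ m r → r < s → m * (s + s + s) + s + r ≡ z → Split₃ s z
  third  : ∀ m r → r < s → m * (s + s + s) + (s + s) + r ≡ z → Split₃ s z

split₃ : ∀ {s} → 0 < s → ∀ z → Split₃ s z
split₃ 0<s zero = first 0 0 0<s refl
split₃ {s} 0<s (suc z) with split₃ 0<s z
... | first m r r<s e with m≤n⇒m<n∨m≡n r<s
...   | inj₁ r+1<s = first m (suc r) r+1<s (trans (+-suc _ r) (cong suc e))
...   | inj₂ refl  = second m 0 0<s (trans (by-ring m r) (cong suc e))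
  where
  by-ring : ∀ m r → m * (suc r + suc r + suc r) + suc r + 0 ≡ suc (m * (suc r + suc r + suc r) + r)
  by-ring = solve-∀
split₃ {s} 0<s (suc z) | second m r r<s e with m≤n⇒m<n∨m≡n r<s
...   | inj₁ r+1<s = second m (suc r) r+1<s (trans (+-suc _ r) (cong suc e))
...   | inj₂ refl  = third m 0 0<s (trans (by-ring m r) (cong suc e))
  where
  by-ring : ∀ m r → m * (suc r + suc r + suc r) + (suc r + suc r) + 0 ≡ suc (m * (suc r + suc r + suc r) + suc r + r)
  by-ring = solve-∀
split₃ {s} 0<s (suc z) | third m r r<s e with m≤n⇒m<n∨m≡n r<s
...   | inj₁ r+1<s = third m (suc r) r+1<s (trans (+-suc _ r) (cong suc e))
...   | inj₂ refl  = first (suc m) 0 0<s (trans (by-ring m r) (cong suc e))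
  where
  by-ring : ∀ m r → suc m * (suc r + suc r + suc r) + 0 ≡ suc (m * (suc r + suc r + suc r) + (suc r + suc r) + r)
  by-ring = solve-∀

period-≥ : ∀ m x → x ≤ suc m * x + 0
period-≥ m x = ≤-trans (m≤m+n x (m * x)) (≤-reflexive (sym (+-identityʳ _)))

first+s : ∀ m s r → m * (s + s) + r + s ≡ m * (s + s) + s + r
first+s = solve-∀

second+s : ∀ m s r → m * (s + s) + s + r + s ≡ suc m * (s + s) + r
second+s = solve-∀

first+s₃ : ∀ m s r → m * (s + s + s) + r + s ≡ m * (s + s + s) + s + r
first+s₃ = solve-∀

first+2s₃ : ∀ m s r → m * (s + s + s) + r + (s + s) ≡ m * (s + s + s) + (s + s) + r
first+2s₃ = solve-∀

second+2s₃ : ∀ m s r → m * (s + s + s) + s + r + (s + s) ≡ suc m * (s + s + s) + r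
second+2s₃ = solve-∀

third+s₃ : ∀ m s r → m * (s + s + s) + (s + s) + r + s ≡ suc m * (s + s + s) + r
third+s₃ = solve-∀

one-period : ∀ s → 1 * (s + s) + 0 ≡ s + s
one-period = solve-∀

module PrefixTiling
  (S : ℕ → Set) (s a R : ℕ) (2≤s : 2 ≤ s) (s<a : s < a)
  (covered    : ∀ {z} → z < R → Covered S s a z)
  (s-apart    : ∀ {w z} → S w → S z → w + s ≡ z → ⊥)
  (a-apart    : ∀ {w z} → S w → S z → w + a ≡ z → ⊥)
  (sa-apart   : ∀ {w w' z} → z ≤ R → S w → S w' → w + s ≡ z → w' + a ≡ z → ⊥)
  (gap        : ¬ Covered S s a R)
  (before-gap : ∀ {z} → suc z ≡ R → ¬ S z)
  (after-gap  : suc s ≢ a → Step S s (suc R) ⊎ Step S a (suc R))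
  where

  0<s : 0 < s
  0<s = ≤-trans (s≤s z≤n) 2≤s

  1<s : 1 < s
  1<s = 2≤s

  s+1≤2s : suc s ≤ s + s
  s+1≤2s = subst (_≤ s + s) (+-comm s 1) (+-monoʳ-≤ s 0<s)

  unstepped : ∀ {z} → z < R → ¬ Step S s z → ¬ Step S a z → S z
  unstepped z<R ¬s ¬a with covered z<R
  ... | inj₁ Sz         = Sz
  ... | inj₂ (inj₁ st)  = ⊥-elim (¬s st)
  ... | inj₂ (inj₂ st)  = ⊥-elim (¬a st)

  -- The first s points lie in S: no step of length s or a ends there.
  top-block : ∀ {z} → z < s → z < R → S z
  top-block z<s′ z<R = unstepped z<R
    (λ (_ , e , _) → <⇒≱ z<s′ (step-≥ e))
    (λ (_ , e , _) → <⇒≱ (<-trans z<s′ s<a) (step-≥ e))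

  covered-below-a : ∀ {z} → z < a → z < R → S z ⊎ Step S s z
  covered-below-a z<a z<R with covered z<R
  ... | inj₁ Sz                 = inj₁ Sz
  ... | inj₂ (inj₁ st)          = inj₂ st
  ... | inj₂ (inj₂ (_ , e , _)) = contradiction (step-≥ e) (<⇒≱ z<a)

  in-first   : ∀ m {r} → r < s → m * (s + s) + r < a → m * (s + s) + r < R → S (m * (s + s) + r)
  not-second : ∀ m {r} → r < s → m * (s + s) + s + r < a → m * (s + s) + s + r < R → ¬ S (m * (s + s) + s + r)

  not-second m {r} r<s za zR Sz =
    s-apart (in-first m r<s (<-trans before za) (<-trans before zR)) Sz (first+s m s r)
    where
    before : m * (s + s) + r < m * (s + s) + s + r
    before = start-< (first+s m s r) 0<s

  in-first zero r<s _ zR = top-block r<s zR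
  in-first (suc m) {r} r<s za zR with covered-below-a za zR
  ... | inj₁ Sz         = Sz
  ... | inj₂ (w , e , Sw) =
    ⊥-elim (not-second m r<s (<-trans before za) (<-trans before zR) (subst S (same-start e (second+s m s r)) Sw))
    where
    before : m * (s + s) + s + r < suc m * (s + s) + r
    before = start-< (second+s m s r) 0<s

  two-s∈S : s + s < a → s + s < R → S (s + s)
  two-s∈S 2s<a 2s<R = subst S (one-period s)
    (in-first 1 0<s (subst (_< a) (sym (one-period s)) 2s<a) (subst (_< R) (sym (one-period s)) 2s<R))

  module Period₃ (a≡2s : a ≡ s + s) where
    in-first₃  : ∀ m {r} → r < s → m * (s + s + s) + r < R → S (m * (s + s + s) + r)
    not-second₃ : ∀ m {r} → r < s → m * (s + s + s) + s + r < R → ¬ S (m * (s + s + s) + s + r)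
    not-third₃  : ∀ m {r} → r < s → m * (s + s + s) + (s + s) + r < R → ¬ S (m * (s + s + s) + (s + s) + r)

    not-second₃ m {r} r<s zR Sz = s-apart (in-first₃ m r<s (<-trans (start-< (first+s₃ m s r) 0<s) zR)) Sz (first+s₃ m s r)

    not-third₃ m {r} r<s zR Sz = a-apart (in-first₃ m r<s (<-trans before zR)) Sz shifted
      where
      shifted : m * (s + s + s) + r + a ≡ m * (s + s + s) + (s + s) + r
      shifted = trans (cong (m * (s + s + s) + r +_) a≡2s) (first+2s₃ m s r)
      before : m * (s + s + s) + r < m * (s + s + s) + (s + s) + r
      before = start-< (first+2s₃ m s r) (≤-trans 0<s (m≤m+n s s))

    in-first₃ zero r<s zR = top-block r<s zR
    in-first₃ (suc m) {r} r<s zR with covered zR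
    ... | inj₁ Sz = Sz
    ... | inj₂ (inj₁ (w , e , Sw)) =
      ⊥-elim (not-third₃ m r<s (<-trans (start-< (third+s₃ m s r) 0<s) zR) (subst S (same-start e (third+s₃ m s r)) Sw))
    ... | inj₂ (inj₂ (w , e , Sw)) =
      ⊥-elim (not-second₃ m r<s (<-trans before zR) (subst S (same-start e shifted) Sw))
      where
      shifted : m * (s + s + s) + s + r + a ≡ suc m * (s + s + s) + r
      shifted = trans (cong (m * (s + s + s) + s + r +_) a≡2s) (second+2s₃ m s r)
      before : m * (s + s + s) + s + r < suc m * (s + s + s) + r
      before = start-< (second+2s₃ m s r) (≤-trans 0<s (m≤m+n s s))

  below-a : 0 < R → R < a → ∃ λ m → R ≡ suc m * (s + s) × a ≡ suc R
  below-a 0<R R<a with split₂ 0<s R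
  ... | second m r r<s′ e = ⊥-elim (gap (inj₂ (inj₁ (_ , trans (first+s m s r) e , S-w))))
    where
    w<R : m * (s + s) + r < R
    w<R = start-< (trans (first+s m s r) e) 0<s
    S-w : S (m * (s + s) + r)
    S-w = in-first m r<s′ (<-trans w<R R<a) w<R
  ... | first m (suc r) r<s′ e = ⊥-elim (before-gap pred-R (in-first m r<s″ (<-trans w<R R<a) w<R))
    where
    r<s″ : r < s
    r<s″ = <-trans (n<1+n r) r<s′
    pred-R : suc (m * (s + s) + r) ≡ R
    pred-R = trans (sym (+-suc _ r)) e
    w<R : m * (s + s) + r < R
    w<R = ≤-reflexive pred-R
  ... | first zero zero _ e = contradiction (sym e) (>⇒≢ 0<R)
  ... | first (suc m) zero _ e with after-gap (λ s+1≡a → <⇒≢ s+1<a s+1≡a)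
    where
    s+1<a : suc s < a
    s+1<a = ≤-<-trans (≤-trans s+1≤2s (≤-trans (period-≥ m (s + s)) (≤-reflexive e))) R<a
  ...   | inj₁ (w , e′ , S-w) = ⊥-elim (not-second m 1<s (<-trans w<R R<a) w<R (subst S (same-start e′ shift) S-w))
    where
    shift′ : ∀ m s → m * (s + s) + s + 1 + s ≡ suc (suc m * (s + s) + 0)
    shift′ = solve-∀
    shift : m * (s + s) + s + 1 + s ≡ suc R
    shift = trans (shift′ m s) (cong suc e)
    w<R : m * (s + s) + s + 1 < R
    w<R = start-<-pred shift 1<s
  ...   | inj₂ (w , e′ , S-w) = m , trans (sym e) (+-identityʳ _) , ≤-antisym (step-≥ e′) R<a

  -- Case a = 2s: the three-periodic pattern leaves no room for the gap at R.
  period₃-impossible : a ≡ s + s → 0 < R → ⊥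
  period₃-impossible a≡2s 0<R with split₃ 0<s R
  ... | second m r r<s′ e = gap (inj₂ (inj₁ (_ , trans (first+s₃ m s r) e , in-first₃ m r<s′ w<R)))
    where
    open Period₃ a≡2s
    w<R : m * (s + s + s) + r < R
    w<R = start-< (trans (first+s₃ m s r) e) 0<s
  ... | third m r r<s′ e = gap (inj₂ (inj₂ (_ , trans shifted e , in-first₃ m r<s′ w<R)))
    where
    open Period₃ a≡2s
    shifted : m * (s + s + s) + r + a ≡ m * (s + s + s) + (s + s) + r
    shifted = trans (cong (m * (s + s + s) + r +_) a≡2s) (first+2s₃ m s r)
    w<R : m * (s + s + s) + r < R
    w<R = start-< (trans shifted e) (<-trans 0<s s<a)
  ... | first m (suc r) r<s′ e = before-gap pred-R (in-first₃ m (<-trans (n<1+n r) r<s′) (≤-reflexive pred-R))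
    where
    open Period₃ a≡2s
    pred-R : suc (m * (s + s + s) + r) ≡ R
    pred-R = trans (sym (+-suc _ r)) e
  ... | first zero zero _ e = >⇒≢ 0<R (sym e)
  ... | first (suc m) zero _ e with after-gap (λ s+1≡a → <⇒≢ (+-monoʳ-< s 1<s) (trans (+-comm s 1) (trans s+1≡a a≡2s)))
  ...   | inj₁ (w , e′ , S-w) = not-third₃ m 1<s (start-<-pred shifted 1<s) (subst S (same-start e′ shifted) S-w)
    where
    open Period₃ a≡2s
    shift : ∀ m s → m * (s + s + s) + (s + s) + 1 + s ≡ suc (suc m * (s + s + s) + 0)
    shift = solve-∀
    shifted : m * (s + s + s) + (s + s) + 1 + s ≡ suc R
    shifted = trans (shift m s) (cong suc e)
  ...   | inj₂ (w , e′ , S-w) = not-second₃ m 1<s (start-<-pred shifted (<-trans 1<s s<a)) (subst S (same-start e′ shifted) S-w)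
    where
    open Period₃ a≡2s
    shift : ∀ m s → m * (s + s + s) + s + 1 + (s + s) ≡ suc (suc m * (s + s + s) + 0)
    shift = solve-∀
    shifted : m * (s + s + s) + s + 1 + a ≡ suc R
    shifted = trans (cong (m * (s + s + s) + s + 1 +_) a≡2s) (trans (shift m s) (cong suc e))

  module AboveA (a<R : a < R) where
    0<R : 0 < R
    0<R = ≤-<-trans z≤n a<R

    S-0 : S 0
    S-0 = top-block 0<s 0<R

    -- a is covered by the a-step from 0, hence by nothing else.
    a∉S : ¬ S a
    a∉S S-a = a-apart S-0 S-a refl

    a-not-s-step : ¬ Step S s a
    a-not-s-step (w , e , S-w) = sa-apart (<⇒≤ a<R) S-w S-0 e refl

    -- R lies at least s above a: otherwise R - a ∈ [0, s) would reach R.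
    a+s≤R : a + s ≤ R
    a+s≤R with a + s ≤? R
    ... | yes le = le
    ... | no  gt = ⊥-elim (gap (inj₂ (inj₂ (R ∸ a , e , top-block w<s (<-trans w<s (<-trans s<a a<R))))))
      where
      e : R ∸ a + a ≡ R
      e = m∸n+n≡m (<⇒≤ a<R)
      w<s : R ∸ a < s
      w<s = +-cancelʳ-< a (R ∸ a) s (subst₂ _<_ (sym e) (+-comm a s) (≰⇒> gt))

    module EvenMultiple {m} (e : suc (suc m) * (s + s) + 0 ≡ a) where
      2s<a : s + s < a
      2s<a = <-≤-trans (m<m+n (s + s) (≤-trans 0<s (m≤m+n s s))) (≤-trans (four-s≤ m s) (≤-reflexive e))
        where
        four-s≤ : ∀ m s → s + s + (s + s) ≤ suc (suc m) * (s + s) + 0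
        four-s≤ m s = subst (s + s + (s + s) ≤_) (by-ring m s) (m≤m+n (s + s + (s + s)) (m * (s + s)))
          where
          by-ring : ∀ m s → s + s + (s + s) + m * (s + s) ≡ suc (suc m) * (s + s) + 0
          by-ring = solve-∀

      s+1<a : s + 1 < a
      s+1<a = ≤-<-trans (subst (_≤ s + s) (+-comm 1 s) s+1≤2s) 2s<a

      -- R = a + s: R + 1 is reached neither from a + 1 (as 1 ∈ S) nor from s + 1.
      at-a+s : a + s ≡ R → ⊥
      at-a+s a+s≡R with after-gap (λ s+1≡a → <⇒≢ (subst (_< a) (+-comm s 1) s+1<a) s+1≡a)
      ... | inj₁ (w , e′ , S-w) = a-apart (top-block 1<s (<-trans 1<s (<-trans s<a a<R))) S-w (sym w≡1+a)
        where
        w≡1+a : w ≡ 1 + a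
        w≡1+a = +-cancelʳ-≡ s w (1 + a) (trans e′ (cong suc (sym a+s≡R)))
      ... | inj₂ (w , e′ , S-w) = not-second 0 1<s s+1<a (<-trans s+1<a a<R) (subst S w≡s+1 S-w)
        where
        by-ring : ∀ a s → suc (a + s) ≡ s + 1 + a
        by-ring = solve-∀
        w≡s+1 : w ≡ s + 1
        w≡s+1 = +-cancelʳ-≡ a w (s + 1) (trans e′ (trans (cong suc (sym a+s≡R)) (by-ring a s)))

      -- a + s < R ≤ a + 2s: R - 1 is not in S and is reached neither from
      -- [a, a + s) (a-step of [0, s)) nor from [s, 2s) (outside S).
      module Near (a+s<R : a + s < R) (R≤a+2s : R ≤ a + s + s) where
        z : ℕ
        z = pred R
        z+1≡R : suc z ≡ R
        z+1≡R = suc-pred R ⦃ >-nonZero 0<R ⦄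
        z<R : z < R
        z<R = ≤-reflexive z+1≡R
        a+s≤z : a + s ≤ z
        a+s≤z = ≤-pred (subst (a + s <_) (sym z+1≡R) a+s<R)
        z<a+2s : z < a + s + s
        z<a+2s = <-≤-trans z<R R≤a+2s

        impossible : ⊥
        impossible with covered z<R
        ... | inj₁ S-z = before-gap z+1≡R S-z
        ... | inj₂ (inj₁ (w , e′ , S-w)) = a-apart (top-block t<s (<-trans t<s (<-trans s<a a<R))) S-w t+a≡w
          where
          a≤w : a ≤ w
          a≤w = +-cancelʳ-≤ s a w (subst (a + s ≤_) (sym e′) a+s≤z)
          t+a≡w : w ∸ a + a ≡ w
          t+a≡w = m∸n+n≡m a≤w
          t<s : w ∸ a < s
          t<s = +-cancelʳ-< a (w ∸ a) s (subst₂ _<_ (sym t+a≡w) (+-comm a s)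
                  (+-cancelʳ-< s w (a + s) (subst (_< a + s + s) (sym e′) z<a+2s)))
        ... | inj₂ (inj₂ (w , e′ , S-w)) = not-second 0 t<s s+t<a (<-trans s+t<a a<R) (subst S (sym s+t≡w) S-w)
          where
          by-ring : ∀ a s → a + s + s ≡ s + s + a
          by-ring = solve-∀
          s≤w : s ≤ w
          s≤w = +-cancelʳ-≤ a s w (subst₂ _≤_ (+-comm a s) (sym e′) a+s≤z)
          s+t≡w : s + (w ∸ s) ≡ w
          s+t≡w = m+[n∸m]≡n s≤w
          w<2s : w < s + s
          w<2s = +-cancelʳ-< a w (s + s) (subst₂ _<_ (sym e′) (by-ring a s) z<a+2s)
          t<s : w ∸ s < s
          t<s = +-cancelˡ-< s (w ∸ s) s (subst (_< s + s) (sym s+t≡w) w<2s)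
          s+t<a : s + (w ∸ s) < a
          s+t<a = subst (_< a) (sym s+t≡w) (<-trans w<2s 2s<a)

      -- a + 2s < R: a + s ∈ S and 2s ∈ S both cover a + 2s.
      far : a + s + s < R → ⊥
      far a+2s<R = sa-apart (<⇒≤ a+2s<R) S-a+s (two-s∈S 2s<a (<-trans 2s<a a<R)) refl (by-ring a s)
        where
        by-ring : ∀ a s → s + s + a ≡ a + s + s
        by-ring = solve-∀
        S-a+s : S (a + s)
        S-a+s = unstepped (<-trans (m<m+n (a + s) 0<s) a+2s<R)
          (λ (w , e′ , S-w) → a∉S (subst S (+-cancelʳ-≡ s w a e′) S-w))
          (λ (w , e′ , S-w) → s-apart S-0 (subst S (+-cancelʳ-≡ a w s (trans e′ (+-comm a s))) S-w) refl)

      impossible : ⊥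
      impossible with m≤n⇒m<n∨m≡n a+s≤R
      ... | inj₂ a+s≡R = at-a+s a+s≡R
      ... | inj₁ a+s<R with R ≤? a + s + s
      ...   | yes R≤a+2s = Near.impossible a+s<R R≤a+2s
      ...   | no  R≰a+2s = far (≰⇒> R≰a+2s)

    -- Writing a = 2ms + c·s + r (c < 2, r < s): an odd block (c = 1) makes a an
    -- s-step from S; a nonzero remainder makes 2ms + s doubly covered; a = 2s is
    -- excluded and larger even multiples are impossible by the above.
    impossible : a ≢ s + s → ⊥
    impossible a≢2s with split₂ 0<s a
    ... | second m r r<s′ e = a-not-s-step (_ , trans (first+s m s r) e , in-first m r<s′ w<a (<-trans w<a a<R))
      where
      w<a : m * (s + s) + r < a
      w<a = start-< (trans (first+s m s r) e) 0<s
    ... | first zero r r<s′ e = <⇒≱ (<-trans r<s′ s<a) (≤-reflexive (sym e))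
    ... | first (suc zero) zero _ e = a≢2s (trans (sym e) (one-period s))
    ... | first (suc (suc m)) zero _ e = EvenMultiple.impossible {m} e
    ... | first (suc m) (suc r) r<s′ e =
      sa-apart z≤R S-b₀ (top-block u<s (<-trans u<s (<-trans s<a a<R))) refl u+a≡b₀+s
      where
      b₀ = suc m * (s + s) + 0
      b₀+r≡a : b₀ + suc r ≡ a
      b₀+r≡a = trans (cong (_+ suc r) (+-identityʳ (suc m * (s + s)))) e
      b₀<a : b₀ < a
      b₀<a = start-< b₀+r≡a (s≤s z≤n)
      S-b₀ : S b₀
      S-b₀ = in-first (suc m) 0<s b₀<a (<-trans b₀<a a<R)
      u = s ∸ suc r
      r+u≡s : suc r + u ≡ s
      r+u≡s = m+[n∸m]≡n (<⇒≤ r<s′)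
      u<s : u < s
      u<s = start-< (trans (+-comm u (suc r)) r+u≡s) (s≤s z≤n)
      by-ring : ∀ u b₀ r → u + (b₀ + r) ≡ b₀ + (r + u)
      by-ring = solve-∀
      u+a≡b₀+s : u + a ≡ b₀ + s
      u+a≡b₀+s = trans (cong (u +_) (sym b₀+r≡a)) (trans (by-ring u b₀ (suc r)) (cong (b₀ +_) r+u≡s))
      z≤R : b₀ + s ≤ R
      z≤R = ≤-trans (+-monoˡ-≤ s (<⇒≤ b₀<a)) a+s≤R

  classification : 0 < R → ∃ λ m → R ≡ suc m * (s + s) × a ≡ suc R
  classification 0<R with a ≟ s + s
  ... | yes a≡2s = ⊥-elim (period₃-impossible a≡2s 0<R)
  ... | no a≢2s with <-cmp R a
  ...   | tri< R<a _ _ = below-a 0<R R<a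
  ...   | tri≈ _ R≡a _ = ⊥-elim (gap (inj₂ (inj₂ (0 , sym R≡a , top-block 0<s 0<R))))
  ...   | tri> _ _ a<R = ⊥-elim (AboveA.impossible a<R a≢2s)

dist-cases : ∀ x y {d} → ∣ x - y ∣ ≡ d → x + d ≡ y ⊎ y + d ≡ x
dist-cases x y refl with ≤-total x y
... | inj₁ x≤y = inj₁ (trans (cong (x +_) (m≤n⇒∣m-n∣≡n∸m x≤y)) (m+[n∸m]≡n x≤y))
... | inj₂ y≤x = inj₂ (trans (cong (y +_) (m≤n⇒∣n-m∣≡n∸m y≤x)) (m+[n∸m]≡n y≤x))

fin2 : ∀ {i i' : Fin 2} → i ≢ i' → ∀ x → x ≡ i ⊎ x ≡ i'
fin2 {zero}     {zero}     i≢i' _          = ⊥-elim (i≢i' refl)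
fin2 {zero}     {suc zero} _    zero       = inj₁ refl
fin2 {zero}     {suc zero} _    (suc zero) = inj₂ refl
fin2 {suc zero} {zero}     _    zero       = inj₂ refl
fin2 {suc zero} {zero}     _    (suc zero) = inj₁ refl
fin2 {suc zero} {suc zero} i≢i' _          = ⊥-elim (i≢i' refl)

module Obstruction {n k : ℕ} (3≤k : 3 ≤ k) {f : Slot n → ℕ} (sg : IsSuperGraceful k (K 2 n) f) where
  open IsSuperGraceful sg

  M : ℕ
  M = k + (2 + n) + 2 * n ∸ 1

  M-value : M ≡ k + 3 * n + 1
  M-value = cong (_∸ 1) (by-ring k n)
    where
    by-ring : ∀ k n → k + (2 + n) + 2 * n ≡ suc (k + 3 * n + 1)
    by-ring = solve-∀

  α : Fin 2 → ℕ
  α i = f (A i)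

  β : Fin n → ℕ
  β j = f (B j)

  k≤ : ∀ x → k ≤ f x
  k≤ x = proj₁ (into x)

  ≤M : ∀ x → f x ≤ M
  ≤M x = proj₂ (into x)

  edge-≥k : ∀ i j → k ≤ ∣ α i - β j ∣
  edge-≥k i j = subst (k ≤_) (edge-label (i , j)) (k≤ (edge i j))

  α-injective : ∀ {i i'} → α i ≡ α i' → i ≡ i'
  α-injective {i} e with injective (A i) _ e
  ... | refl = refl

  edge-injective : ∀ {i j i' j'} → ∣ α i - β j ∣ ≡ ∣ α i' - β j' ∣ → i ≡ i' × j ≡ j'
  edge-injective {i} {j} {i'} {j'} e with injective (edge i j) (edge i' j') (trans (edge-label (i , j)) (trans e (sym (edge-label (i' , j')))))
  ... | refl = refl , refl

  β≢edge : ∀ {j i j'} → β j ≢ ∣ α i - β j' ∣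
  β≢edge {j} {i} {j'} e with injective (B j) (edge i j') (trans e (sym (edge-label (i , j'))))
  ... | ()

  α≢β : ∀ {i j} → α i ≢ β j
  α≢β {i} {j} e with injective (A i) (B j) e
  ... | ()

  α≢edge : ∀ {i i' j} → α i ≢ ∣ α i' - β j ∣
  α≢edge {i} {i'} {j} e with injective (A i) (edge i' j) (trans e (sym (edge-label (i' , j))))
  ... | ()

  -- Labels seen from the top: label x lies at depth z when x + z = M.
  same-depth : ∀ {x y z} → x + z ≡ M → y + z ≡ M → x ≡ y
  same-depth {x} {y} {z} e e' = +-cancelʳ-≡ z x y (trans e (sym e'))

  edge-depth : ∀ {j c w z} → β j + w ≡ M → w + c ≡ z → z ≤ M → ∣ c - β j ∣ + z ≡ M
  edge-depth {j} {c} {w} {z} e e′ z≤M = begin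
    ∣ c - β j ∣ + z      ≡⟨ cong (_+ z) (m≤n⇒∣m-n∣≡n∸m c≤β) ⟩
    β j ∸ c + z          ≡⟨ cong (β j ∸ c +_) (sym e′) ⟩
    β j ∸ c + (w + c)    ≡⟨ by-ring (β j ∸ c) w c ⟩
    w + (β j ∸ c + c)    ≡⟨ cong (w +_) (m∸n+n≡m c≤β) ⟩
    w + β j              ≡⟨ +-comm w (β j) ⟩
    β j + w              ≡⟨ e ⟩
    M                    ∎
    where
    open ≡-Reasoning
    by-ring : ∀ x y z → x + (y + z) ≡ y + (x + z)
    by-ring = solve-∀
    c≤β : c ≤ β j
    c≤β = +-cancelˡ-≤ w c (β j) (subst₂ _≤_ (sym e′) (trans (sym e) (+-comm (β j) w)) z≤M)

  edge-+k≤M : ∀ i j → ∣ α i - β j ∣ + k ≤ M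
  edge-+k≤M i j with dist-cases (α i) (β j) refl
  ... | inj₁ e = ≤-trans (≤-reflexive (+-comm _ k)) (≤-trans (+-monoˡ-≤ _ (k≤ (A i))) (≤-trans (≤-reflexive e) (≤M (B j))))
  ... | inj₂ e = ≤-trans (≤-reflexive (+-comm _ k)) (≤-trans (+-monoˡ-≤ _ (k≤ (B j))) (≤-trans (≤-reflexive e) (≤M (A i))))

  module Ordered {i i' : Fin 2} (i≢i' : i ≢ i') (s<a : α i < α i') where
    s a R : ℕ
    s = α i
    a = α i'
    R = M ∸ a

    a+R≡M : a + R ≡ M
    a+R≡M = m+[n∸m]≡n (≤M (A i'))

    R+a≡M : R + a ≡ M
    R+a≡M = trans (+-comm R a) a+R≡M

    data Label (x : ℕ) : Set where
      is-s   : x ≡ s → Label x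
      is-a   : x ≡ a → Label x
      is-B   : ∀ j → β j ≡ x → Label x
      s-edge : ∀ j → ∣ s - β j ∣ ≡ x → Label x
      a-edge : ∀ j → ∣ a - β j ∣ ≡ x → Label x

    label : ∀ {x} → k ≤ x → x ≤ M → Label x
    label k≤x x≤M with onto _ (k≤x , x≤M)
    ... | A i″ , e with fin2 i≢i' i″
    ...   | inj₁ refl = is-s (sym e)
    ...   | inj₂ refl = is-a (sym e)
    label k≤x x≤M | B j , e = is-B j e
    label k≤x x≤M | edge i″ j , e with fin2 i≢i' i″
    ...   | inj₁ refl = s-edge j (trans (sym (edge-label (i , j))) e)
    ...   | inj₂ refl = a-edge j (trans (sym (edge-label (i' , j))) e)

    0<a : 0 < a
    0<a = ≤-<-trans z≤n s<a

    R≤M : R ≤ M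
    R≤M = step-≥ a+R≡M

    β>2 : ∀ {j} → β j ≤ 2 → ⊥
    β>2 {j} le = <⇒≱ 3≤k (≤-trans (k≤ (B j)) le)

    a-edge>2 : ∀ {j} → ∣ a - β j ∣ ≤ 2 → ⊥
    a-edge>2 {j} le = <⇒≱ 3≤k (≤-trans (edge-≥k i' j) le)

    Depth : ℕ → Set
    Depth z = ∃ λ j → β j + z ≡ M

    depth-step : ∀ {c x z j} → c + x ≡ β j → x + z ≡ M → Step Depth c z
    depth-step {c} {x} {z} {j} e e′ = M ∸ β j , w+c≡z , j , m+[n∸m]≡n (≤M (B j))
      where
      w+c≡z : M ∸ β j + c ≡ z
      w+c≡z = +-cancelʳ-≡ x (M ∸ β j + c) z (begin
        M ∸ β j + c + x     ≡⟨ +-assoc (M ∸ β j) c x ⟩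
        M ∸ β j + (c + x)   ≡⟨ cong (M ∸ β j +_) e ⟩
        M ∸ β j + β j       ≡⟨ m∸n+n≡m (≤M (B j)) ⟩
        M                   ≡⟨ e′ ⟨
        x + z               ≡⟨ +-comm x z ⟩
        z + x               ∎)
        where open ≡-Reasoning

    -- Every label above a is a B-vertex or an edge going down from one.
    covered : ∀ {z} → z < R → Covered Depth s a z
    covered {z} z<R = from-label (label k≤x (m∸n≤m M z))
      where
      x+z≡M : M ∸ z + z ≡ M
      x+z≡M = m∸n+n≡m (≤-trans (<⇒≤ z<R) R≤M)
      a<x : a < M ∸ z
      a<x = +-cancelʳ-< z a (M ∸ z) (subst (a + z <_) (trans a+R≡M (sym x+z≡M)) (+-monoʳ-< a z<R))
      k≤x : k ≤ M ∸ z
      k≤x = ≤-trans (k≤ (A i')) (<⇒≤ a<x)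
      from-label : Label (M ∸ z) → Covered Depth s a z
      from-label (is-s e)   = ⊥-elim (<⇒≱ (<-trans s<a a<x) (≤-reflexive e))
      from-label (is-a e)   = ⊥-elim (<⇒≱ a<x (≤-reflexive e))
      from-label (is-B j e) = inj₁ (j , trans (cong (_+ z) e) x+z≡M)
      from-label (s-edge j e) with dist-cases s (β j) e
      ... | inj₁ up   = inj₂ (inj₁ (depth-step up x+z≡M))
      ... | inj₂ down = ⊥-elim (<⇒≱ (<-trans s<a a<x) (step-≥ down))
      from-label (a-edge j e) with dist-cases a (β j) e
      ... | inj₁ up   = inj₂ (inj₂ (depth-step up x+z≡M))
      ... | inj₂ down = ⊥-elim (<⇒≱ a<x (step-≥ down))

    -- No B-vertex sits where an edge of another B-vertex to s or a sits.
    s-apart : ∀ {w z} → Depth w → Depth z → w + s ≡ z → ⊥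
    s-apart (j' , e') (j , e) st = β≢edge (same-depth e (edge-depth e' st (step-≥ e)))

    a-apart : ∀ {w z} → Depth w → Depth z → w + a ≡ z → ⊥
    a-apart (j' , e') (j , e) st = β≢edge (same-depth e (edge-depth e' st (step-≥ e)))

    -- No edge to s sits where an edge to a sits.
    sa-apart : ∀ {w w' z} → z ≤ M → Depth w → Depth w' → w + s ≡ z → w' + a ≡ z → ⊥
    sa-apart z≤M (j , e) (j' , e') st st' =
      i≢i' (proj₁ (edge-injective (same-depth (edge-depth e st z≤M) (edge-depth e' st' z≤M))))

    -- Nothing but a itself sits at depth R.
    gap : ¬ Covered Depth s a R
    gap (inj₁ (j , e))                 = α≢β (same-depth a+R≡M e)
    gap (inj₂ (inj₁ (w , st , j , e))) = α≢edge (same-depth a+R≡M (edge-depth e st R≤M))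
    gap (inj₂ (inj₂ (w , st , j , e))) = α≢edge (same-depth a+R≡M (edge-depth e st R≤M))

    -- a + 1 is not a B-vertex: the edge between them would have label 1.
    before-gap : ∀ {z} → suc z ≡ R → ¬ Depth z
    before-gap {z} z+1≡R (j , e) = a-edge>2 (≤-trans (≤-reflexive (dist-up a (β j) 1 (sym β≡a+1))) (n≤1+n 1))
      where
      β≡a+1 : β j ≡ a + 1
      β≡a+1 = +-cancelʳ-≡ z (β j) (a + 1) (trans e (sym (trans (+-assoc a 1 z) (trans (cong (a +_) z+1≡R) a+R≡M))))

    a-1+1≡a : suc (pred a) ≡ a
    a-1+1≡a = suc-pred a ⦃ >-nonZero 0<a ⦄

    s≤a-1 : s ≤ pred a
    s≤a-1 = ≤-pred (subst (suc s ≤_) (sym a-1+1≡a) s<a)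

    -- Unless a = s + 1, the label a - 1 is an edge going down from a B-vertex:
    -- it is not a B-vertex (edge of label 1 to a), and an edge from a B-vertex
    -- of label b ≤ 1 is impossible.
    after-gap : suc s ≢ a → Step Depth s (suc R) ⊎ Step Depth a (suc R)
    after-gap s+1≢a = from-label (label (≤-trans (k≤ (A i)) s≤a-1) (≤-trans (n≤1+n (pred a)) (≤-trans (≤-reflexive a-1+1≡a) (≤M (A i')))))
      where
      x+z≡M : pred a + suc R ≡ M
      x+z≡M = trans (+-suc (pred a) R) (trans (cong (_+ R) a-1+1≡a) a+R≡M)
      from-label : Label (pred a) → Step Depth s (suc R) ⊎ Step Depth a (suc R)
      from-label (is-s e)   = ⊥-elim (s+1≢a (trans (cong suc (sym e)) a-1+1≡a))
      from-label (is-a e)   = ⊥-elim (<⇒≢ (≤-reflexive a-1+1≡a) e)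
      from-label (is-B j e) = ⊥-elim (a-edge>2 (≤-trans (≤-reflexive edge≡1) (n≤1+n 1)))
        where
        edge≡1 : ∣ a - β j ∣ ≡ 1
        edge≡1 = dist-down a (β j) 1 (trans (cong (_+ 1) e) (trans (+-comm (pred a) 1) a-1+1≡a))
      from-label (s-edge j e) with dist-cases s (β j) e
      ... | inj₁ up   = inj₁ (depth-step up x+z≡M)
      ... | inj₂ down = ⊥-elim (β>2 (≤-trans (+-cancelʳ-≤ (pred a) (β j) 0 (subst (_≤ pred a) (sym down) s≤a-1)) z≤n))
      from-label (a-edge j e) with dist-cases a (β j) e
      ... | inj₁ up   = inj₂ (depth-step up x+z≡M)
      ... | inj₂ down = ⊥-elim (β>2 (≤-trans (≤-reflexive (+-cancelʳ-≡ (pred a) (β j) 1 (trans down (sym a-1+1≡a)))) (n≤1+n 1)))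

    -- A label x < a above M - k is s: edges lie at most at M - k, and a
    -- B-vertex there would be joined to a by an edge shorter than k.
    high-label-is-s : ∀ {x} → k ≤ x → x < a → M < x + k → x ≡ s
    high-label-is-s {x} k≤x x<a M<x+k = from-label (label k≤x (<⇒≤ (<-≤-trans x<a (≤M (A i')))))
      where
      from-label : Label x → x ≡ s
      from-label (is-s e)     = e
      from-label (is-a e)     = ⊥-elim (<⇒≢ x<a e)
      from-label (is-B j e)   = ⊥-elim (<⇒≱ (+-cancelˡ-< x _ k x+d<x+k) (edge-≥k i' j))
        where
        x+d≡a : x + ∣ a - β j ∣ ≡ a
        x+d≡a = trans (cong (x +_) (trans (cong (∣ a -_∣) e) (m≤n⇒∣n-m∣≡n∸m (<⇒≤ x<a)))) (m+[n∸m]≡n (<⇒≤ x<a))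
        x+d<x+k : x + ∣ a - β j ∣ < x + k
        x+d<x+k = ≤-<-trans (≤-trans (≤-reflexive x+d≡a) (≤M (A i'))) M<x+k
      from-label (s-edge j e) = ⊥-elim (<⇒≱ M<x+k (subst (λ y → y + k ≤ M) e (edge-+k≤M i j)))
      from-label (a-edge j e) = ⊥-elim (<⇒≱ M<x+k (subst (λ y → y + k ≤ M) e (edge-+k≤M i' j)))

    -- a is not the top label: otherwise a - 1 and a - 2 would both be s.
    R-positive : 1 ≤ n → 0 < R
    R-positive 1≤n with R ≟ 0
    ... | no  R≢0 = n≢0⇒n>0 R≢0
    ... | yes R≡0 = ⊥-elim (<⇒≢ (n<1+n t) (trans t≡s (sym t+1≡s)))
      where
      a≡M : a ≡ M
      a≡M = trans (sym (+-identityʳ a)) (trans (cong (a +_) (sym R≡0)) a+R≡M)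
      k+2≤a : k + 2 ≤ a
      k+2≤a = subst (k + 2 ≤_) (sym (trans a≡M M-value)) (k+2≤top k n 1≤n)
        where
        k+2≤top : ∀ k n → 1 ≤ n → k + 2 ≤ k + 3 * n + 1
        k+2≤top k n 1≤n = ≤-trans (+-monoʳ-≤ k (+-monoˡ-≤ 1 (≤-trans 1≤n (m≤m+n n (2 * n))))) (≤-reflexive (sym (+-assoc k (3 * n) 1)))
      t = a ∸ 2
      2+t≡a : 2 + t ≡ a
      2+t≡a = m+[n∸m]≡n (≤-trans (m≤n+m 2 k) k+2≤a)
      k≤t : k ≤ t
      k≤t = +-cancelʳ-≤ 2 k t (subst (k + 2 ≤_) (trans (sym 2+t≡a) (+-comm 2 t)) k+2≤a)
      t+1<a : suc t < a
      t+1<a = ≤-reflexive 2+t≡a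
      t<a : t < a
      t<a = <-trans (n<1+n t) t+1<a
      k≤t+1 : k ≤ suc t
      k≤t+1 = ≤-trans k≤t (n≤1+n t)
      M<t+k : ∀ {x} → t ≤ x → M < x + k
      M<t+k {x} t≤x = subst (_< x + k) (trans 2+t≡a a≡M)
        (<-≤-trans (+-monoˡ-< t 3≤k) (≤-trans (+-monoʳ-≤ k t≤x) (≤-reflexive (+-comm k x))))
      t≡s : t ≡ s
      t≡s = high-label-is-s k≤t t<a (M<t+k ≤-refl)
      t+1≡s : suc t ≡ s
      t+1≡s = high-label-is-s k≤t+1 t+1<a (M<t+k (n≤1+n t))

    0<k : 0 < k
    0<k = ≤-trans (s≤s z≤n) 3≤k

    2≤s : 2 ≤ s
    2≤s = ≤-trans (n≤1+n 2) (≤-trans 3≤k (k≤ (A i)))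

    open PrefixTiling Depth s a R 2≤s s<a covered s-apart a-apart
           (λ z≤R → sa-apart (≤-trans z≤R R≤M)) gap before-gap after-gap

    -- The smallest shape, R = 2s and a = 2s + 1: the labels above s are
    -- exhausted by a, the s topmost B-vertices and their edges, so k = s.
    module Smallest (R≡2s : R ≡ s + s) (a≡R+1 : a ≡ suc R) where
      s<R : s < R
      s<R = subst (s <_) (sym R≡2s) (m<m+n s (≤-trans 0<k (k≤ (A i))))

      top : ∀ {z} → z < s → Depth z
      top z<s′ = top-block z<s′ (<-trans z<s′ s<R)

      -- A B-vertex an a-step below a top vertex collides with its a-edge.
      not-a-step-below-top : ∀ {u} → u < s → ¬ Depth (u + a)
      not-a-step-below-top u<s D = a-apart (top u<s) D refl

      -- A B-vertex of label b < s has the same a-edge label a - b as the top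
      -- vertex at depth b - 1.
      no-low-B : ∀ {j} → β j < s → ⊥
      no-low-B {j} b<s = collide (top b-1<s)
        where
        b-1 = pred (β j)
        b-1+1≡b : suc b-1 ≡ β j
        b-1+1≡b = suc-pred (β j) ⦃ >-nonZero (≤-trans 0<k (k≤ (B j))) ⦄
        b-1<s : b-1 < s
        b-1<s = <-trans (≤-reflexive b-1+1≡b) b<s
        b-1+a≤M : b-1 + a ≤ M
        b-1+a≤M = ≤-trans (+-monoˡ-≤ a (<⇒≤ (<-trans b-1<s s<R))) (≤-reflexive R+a≡M)
        b≤a : β j ≤ a
        b≤a = <⇒≤ (<-trans b<s s<a)
        d+b-1≡R : a ∸ β j + b-1 ≡ R
        d+b-1≡R = suc-injective (begin
          suc (a ∸ β j + b-1)   ≡⟨ +-suc (a ∸ β j) b-1 ⟨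
          a ∸ β j + suc b-1     ≡⟨ cong (a ∸ β j +_) b-1+1≡b ⟩
          a ∸ β j + β j         ≡⟨ m∸n+n≡m b≤a ⟩
          a                     ≡⟨ a≡R+1 ⟩
          suc R                 ∎)
          where open ≡-Reasoning
        edge-j : ∣ a - β j ∣ + (b-1 + a) ≡ M
        edge-j = begin
          ∣ a - β j ∣ + (b-1 + a)   ≡⟨ cong (_+ (b-1 + a)) (m≤n⇒∣n-m∣≡n∸m b≤a) ⟩
          a ∸ β j + (b-1 + a)       ≡⟨ +-assoc (a ∸ β j) b-1 a ⟨
          a ∸ β j + b-1 + a         ≡⟨ cong (_+ a) d+b-1≡R ⟩
          R + a                     ≡⟨ R+a≡M ⟩
          M                         ∎
          where open ≡-Reasoning
        -- The top vertex at depth b - 1 would be B j itself, but b + (b - 1) < 2s = R ≤ M.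
        collide : Depth b-1 → ⊥
        collide (j' , e') with edge-injective (same-depth edge-j (edge-depth e' refl b-1+a≤M))
        ... | _ , refl = <⇒≱ (subst (_< R) e' (<-≤-trans (+-mono-< b<s b-1<s) (≤-reflexive (sym R≡2s)))) R≤M

      -- If k < s, the label k would have to be a low B-vertex, a B-vertex an
      -- a-step below a top vertex, or a B-vertex at depth in [s, 2s).
      module BelowS (k<s : k < s) where
        u = s ∸ k
        k+u≡s : k + u ≡ s
        k+u≡s = m+[n∸m]≡n (<⇒≤ k<s)
        u<s : u < s
        u<s = start-< (trans (+-comm u k) k+u≡s) 0<k

        -- B j = s + k lies at depth (s - k) + a.
        not-s-edge-up : ∀ {j} → s + k ≡ β j → ⊥
        not-s-edge-up {j} up = not-a-step-below-top u<s (j , (begin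
          β j + (u + a)     ≡⟨ cong (_+ (u + a)) (sym up) ⟩
          s + k + (u + a)   ≡⟨ by-ring s k u a ⟩
          s + (k + u) + a   ≡⟨ cong (λ t → s + t + a) k+u≡s ⟩
          s + s + a         ≡⟨ cong (_+ a) (sym R≡2s) ⟩
          R + a             ≡⟨ R+a≡M ⟩
          M                 ∎))
          where
          open ≡-Reasoning
          by-ring : ∀ s k u a → s + k + (u + a) ≡ s + (k + u) + a
          by-ring = solve-∀

        -- B j = a + k lies at depth s + (s - k) ∈ [s, 2s).
        not-a-edge-up : ∀ {j} → a + k ≡ β j → ⊥
        not-a-edge-up {j} up = not-second 0 u<s (<-trans s+u<R R<a) s+u<R (j , (begin
          β j + (s + u)     ≡⟨ cong (_+ (s + u)) (sym up) ⟩
          a + k + (s + u)   ≡⟨ by-ring a k s u ⟩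
          a + (s + (k + u)) ≡⟨ cong (λ t → a + (s + t)) k+u≡s ⟩
          a + (s + s)       ≡⟨ cong (a +_) (sym R≡2s) ⟩
          a + R             ≡⟨ a+R≡M ⟩
          M                 ∎))
          where
          open ≡-Reasoning
          by-ring : ∀ a k s u → a + k + (s + u) ≡ a + (s + (k + u))
          by-ring = solve-∀
          s+u<R : s + u < R
          s+u<R = subst (s + u <_) (sym R≡2s) (+-monoʳ-< s u<s)
          R<a : R < a
          R<a = ≤-reflexive (sym a≡R+1)

        -- B j = a - k lies at depth (k - 1) + a.
        not-a-edge-down : ∀ {j} → β j + k ≡ a → ⊥
        not-a-edge-down {j} down = not-a-step-below-top k-1<s (j , (begin
          β j + (pred k + a) ≡⟨ +-assoc (β j) (pred k) a ⟨
          β j + pred k + a   ≡⟨ cong (_+ a) b+k-1≡R ⟩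
          R + a              ≡⟨ R+a≡M ⟩
          M                  ∎))
          where
          open ≡-Reasoning
          k-1+1≡k : suc (pred k) ≡ k
          k-1+1≡k = suc-pred k ⦃ >-nonZero 0<k ⦄
          k-1<s : pred k < s
          k-1<s = <-trans (≤-reflexive k-1+1≡k) k<s
          b+k-1≡R : β j + pred k ≡ R
          b+k-1≡R = suc-injective (trans (sym (+-suc (β j) (pred k))) (trans (cong (β j +_) k-1+1≡k) (trans down a≡R+1)))

        from-label : Label k → ⊥
        from-label (is-s e)   = <⇒≢ k<s e
        from-label (is-a e)   = <⇒≢ (<-trans k<s s<a) e
        from-label (is-B j e) = no-low-B (subst (_< s) (sym e) k<s)
        from-label (s-edge j e) with dist-cases s (β j) e
        ... | inj₁ up   = not-s-edge-up up
        ... | inj₂ down = no-low-B (start-< down 0<k)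
        from-label (a-edge j e) with dist-cases a (β j) e
        ... | inj₁ up   = not-a-edge-up up
        ... | inj₂ down = not-a-edge-down down

        impossible : ⊥
        impossible = from-label (label ≤-refl (≤-trans (k≤ (A i)) (≤M (A i))))

      k≡s : k ≡ s
      k≡s with m≤n⇒m<n∨m≡n (k≤ (A i))
      ... | inj₁ k<s = ⊥-elim (BelowS.impossible k<s)
      ... | inj₂ k≡s = k≡s

      -- Counting labels: M = k + 3n + 1 and M = a + R = 4s + 1 = 4k + 1.
      k≡n : k ≡ n
      k≡n = *-cancelˡ-≡ k n 3 (+-cancelˡ-≡ (k + 1) (3 * k) (3 * n) (begin
        k + 1 + 3 * k         ≡⟨ by-ring₁ k ⟩
        suc (k + k) + (k + k) ≡⟨ cong (λ t → suc (t + t) + (t + t)) k≡s ⟩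
        suc (s + s) + (s + s) ≡⟨ cong₂ _+_ (cong suc (sym R≡2s)) (sym R≡2s) ⟩
        suc R + R             ≡⟨ cong (_+ R) (sym a≡R+1) ⟩
        a + R                 ≡⟨ a+R≡M ⟩
        M                     ≡⟨ M-value ⟩
        k + 3 * n + 1         ≡⟨ by-ring₂ k n ⟩
        k + 1 + 3 * n         ∎))
        where
        open ≡-Reasoning
        by-ring₁ : ∀ k → k + 1 + 3 * k ≡ suc (k + k) + (k + k)
        by-ring₁ = solve-∀
        by-ring₂ : ∀ k n → k + 3 * n + 1 ≡ k + 1 + 3 * n
        by-ring₂ = solve-∀

    -- A larger shape, R = 2(m+2)s and a = R + 1, is impossible: the label
    -- 2s + 1 collides with an edge of a top B-vertex in every reading.
    module Larger {m} (R≡ : R ≡ suc (suc m) * (s + s)) (a≡R+1 : a ≡ suc R) where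
      t = pred s
      t+1≡s : suc t ≡ s
      t+1≡s = suc-pred s ⦃ >-nonZero 0<s ⦄
      t<s : t < s
      t<s = ≤-reflexive t+1≡s

      R<a : R < a
      R<a = ≤-reflexive (sym a≡R+1)

      core : s + s + s + suc t + m * (s + s) ≡ R
      core = begin
        s + s + s + suc t + m * (s + s) ≡⟨ cong (λ u → s + s + s + u + m * (s + s)) t+1≡s ⟩
        s + s + s + s + m * (s + s)     ≡⟨ by-ring m s ⟩
        suc (suc m) * (s + s)           ≡⟨ R≡ ⟨
        R                               ∎
        where
        open ≡-Reasoning
        by-ring : ∀ m s → s + s + s + s + m * (s + s) ≡ suc (suc m) * (s + s)
        by-ring = solve-∀

      x = s + s + 1

      x≤R : x ≤ R
      x≤R = subst (x ≤_) core (≤-trans (+-monoʳ-≤ (s + s) 0<s)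
              (≤-trans (m≤m+n (s + s + s) (suc t)) (m≤m+n (s + s + s + suc t) (m * (s + s)))))

      s<x : s < x
      s<x = ≤-trans s+1≤2s (m≤m+n (s + s) 1)

      top-in-block : ∀ m′ → m′ * (s + s) + t < R → Depth (m′ * (s + s) + t)
      top-in-block m′ w<R = in-first m′ t<s (<-trans w<R R<a) w<R

      -- B j = 2s + 1: its s-edge s + 1 equals the a-edge of the top vertex
      -- at depth 2(m+1)s + s - 1.
      not-B : ∀ {j} → β j ≡ x → ⊥
      not-B {j} e = sa-apart (≤-trans (≤-reflexive (sym w+a≡z)) (≤-trans (+-monoˡ-≤ a (<⇒≤ w<R)) (≤-reflexive R+a≡M)))
                      (j , b-depth) (top-in-block (suc m) w<R) refl w+a≡z
        where
        open ≡-Reasoning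
        Q = suc m * (s + s)
        w<R : Q + t < R
        w<R = subst (Q + t <_) (trans (by-ring m s) (sym R≡)) (+-monoʳ-< Q (<-≤-trans t<s (m≤m+n s s)))
          where
          by-ring : ∀ m s → suc m * (s + s) + (s + s) ≡ suc (suc m) * (s + s)
          by-ring = solve-∀
        b-depth : β j + (R + Q) ≡ M
        b-depth = begin
          β j + (R + Q)               ≡⟨ cong (_+ (R + Q)) e ⟩
          s + s + 1 + (R + Q)         ≡⟨ by-ring s R Q ⟩
          suc (s + s + Q) + R         ≡⟨ cong (λ u → suc u + R) (sym R≡) ⟩
          suc R + R                   ≡⟨ cong (_+ R) (sym a≡R+1) ⟩
          a + R                       ≡⟨ a+R≡M ⟩
          M                           ∎
          where
          by-ring : ∀ s R Q → s + s + 1 + (R + Q) ≡ suc (s + s + Q) + R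
          by-ring = solve-∀
        w+a≡z : Q + t + a ≡ R + Q + s
        w+a≡z = begin
          Q + t + a                   ≡⟨ cong (Q + t +_) a≡R+1 ⟩
          Q + t + suc R               ≡⟨ by-ring Q t R ⟩
          R + Q + suc t               ≡⟨ cong (R + Q +_) t+1≡s ⟩
          R + Q + s                   ∎
          where
          by-ring : ∀ Q t R → Q + t + suc R ≡ R + Q + suc t
          by-ring = solve-∀

      -- B j = 3s + 1 lies an a-step below the top vertex at depth 2ms + s - 1.
      not-s-edge-up : ∀ {j} → s + x ≡ β j → ⊥
      not-s-edge-up {j} up = a-apart (top-in-block m (start-< w+z≡R (≤-trans 0<s (m≤m+n s x)))) (j , b-depth) refl
        where
        open ≡-Reasoning
        w = m * (s + s) + t
        w+z≡R : w + (s + x) ≡ R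
        w+z≡R = trans (by-ring m s t) core
          where
          by-ring : ∀ m s t → m * (s + s) + t + (s + (s + s + 1)) ≡ s + s + s + suc t + m * (s + s)
          by-ring = solve-∀
        b-depth : β j + (w + a) ≡ M
        b-depth = begin
          β j + (w + a)               ≡⟨ cong (_+ (w + a)) (sym up) ⟩
          s + x + (w + a)             ≡⟨ by-ring (s + x) w a ⟩
          w + (s + x) + a             ≡⟨ cong (_+ a) w+z≡R ⟩
          R + a                       ≡⟨ R+a≡M ⟩
          M                           ∎
          where
          by-ring : ∀ u w a → u + (w + a) ≡ w + u + a
          by-ring = solve-∀

      -- B j = a + 2s + 1 lies at depth 2ms + 2s - 1, in a block missed by the tiling.
      not-a-edge-up : ∀ {j} → a + x ≡ β j → ⊥
      not-a-edge-up {j} up = not-second m t<s (<-trans z<R R<a) z<R (j , b-depth)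
        where
        open ≡-Reasoning
        z = m * (s + s) + s + t
        z+x≡R : z + x ≡ R
        z+x≡R = trans (by-ring m s t) core
          where
          by-ring : ∀ m s t → m * (s + s) + s + t + (s + s + 1) ≡ s + s + s + suc t + m * (s + s)
          by-ring = solve-∀
        z<R : z < R
        z<R = start-< z+x≡R (m≤n+m 1 (s + s))
        b-depth : β j + z ≡ M
        b-depth = begin
          β j + z                     ≡⟨ cong (_+ z) (sym up) ⟩
          a + x + z                   ≡⟨ by-ring a x z ⟩
          a + (z + x)                 ≡⟨ cong (a +_) z+x≡R ⟩
          a + R                       ≡⟨ a+R≡M ⟩
          M                           ∎
          where
          by-ring : ∀ a x z → a + x + z ≡ a + (z + x)
          by-ring = solve-∀

      -- B j = a - 2s - 1 lies an a-step below the top vertex at depth 2s.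
      not-a-edge-down : ∀ {j} → β j + x ≡ a → ⊥
      not-a-edge-down {j} down = a-apart (two-s∈S (<-trans 2s<R R<a) 2s<R) (j , b-depth) refl
        where
        open ≡-Reasoning
        2s<R : s + s < R
        2s<R = <-≤-trans (m<m+n (s + s) (s≤s z≤n)) x≤R
        b+2s≡R : β j + (s + s) ≡ R
        b+2s≡R = suc-injective (trans (by-ring (β j) s) (trans down a≡R+1))
          where
          by-ring : ∀ b s → suc (b + (s + s)) ≡ b + (s + s + 1)
          by-ring = solve-∀
        b-depth : β j + (s + s + a) ≡ M
        b-depth = begin
          β j + (s + s + a)           ≡⟨ +-assoc (β j) (s + s) a ⟨
          β j + (s + s) + a           ≡⟨ cong (_+ a) b+2s≡R ⟩
          R + a                       ≡⟨ R+a≡M ⟩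
          M                           ∎

      from-label : Label x → ⊥
      from-label (is-s e)   = <⇒≢ s<x (sym e)
      from-label (is-a e)   = <⇒≢ (≤-<-trans x≤R R<a) e
      from-label (is-B j e) = not-B e
      from-label (s-edge j e) with dist-cases s (β j) e
      ... | inj₁ up   = not-s-edge-up up
      ... | inj₂ down = <⇒≱ s<x (step-≥ {β j} down)
      from-label (a-edge j e) with dist-cases a (β j) e
      ... | inj₁ up   = not-a-edge-up up
      ... | inj₂ down = not-a-edge-down down

      impossible : ⊥
      impossible = from-label (label (≤-trans (k≤ (A i)) (<⇒≤ s<x)) (≤-trans x≤R R≤M))

    k≡n : 1 ≤ n → k ≡ n
    k≡n 1≤n with classification (R-positive 1≤n)
    ... | zero  , R≡ , a≡R+1 = Smallest.k≡n (trans R≡ (+-identityʳ (s + s))) a≡R+1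
    ... | suc m , R≡ , a≡R+1 = ⊥-elim (Larger.impossible {m} R≡ a≡R+1)

  k≡n : 1 ≤ n → k ≡ n
  k≡n 1≤n with <-cmp (α zero) (α (suc zero))
  ... | tri< α₀<α₁ _ _ = Ordered.k≡n (λ ()) α₀<α₁ 1≤n
  ... | tri≈ _ α₀≡α₁ _ with α-injective α₀≡α₁
  ...   | ()
  k≡n 1≤n | tri> _ _ α₁<α₀ = Ordered.k≡n (λ ()) α₁<α₀ 1≤n

obstruction : ∀ {n k} → 1 ≤ n → 3 ≤ k → SuperGraceful k (K 2 n) → k ≡ n
obstruction 1≤n 3≤k (f , sg) = Obstruction.k≡n 3≤k sg 1≤n

lemma4p5 : (n : ℕ) → 2 ≤ n → (k : ℕ) → 1 ≤ k →
    SuperGraceful k (K 2 n) ⇔ (k ≡ 1 ⊎ k ≡ 2 ⊎ k ≡ n)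
lemma4p5 n 2≤n k 1≤k = mk⇔ (only 1≤k) exists
  where
  only : ∀ {k} → 1 ≤ k → SuperGraceful k (K 2 n) → k ≡ 1 ⊎ k ≡ 2 ⊎ k ≡ n
  only {1}                 _ _  = inj₁ refl
  only {2}                 _ _  = inj₂ (inj₁ refl)
  only {suc (suc (suc _))} _ sg = inj₂ (inj₂ (obstruction (≤-trans (s≤s z≤n) 2≤n) (s≤s (s≤s (s≤s z≤n))) sg))

  exists : k ≡ 1 ⊎ k ≡ 2 ⊎ k ≡ n → SuperGraceful k (K 2 n)
  exists (inj₁ refl)        = Labeling1.labeling n
  exists (inj₂ (inj₁ refl)) = Labeling2.labeling n
  exists (inj₂ (inj₂ refl)) = LabelingN.labeling n
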